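{- Let $p$ be a prime and let $k\le m<n$ be positive integers. Let $\pi:\mathrm{GL}_2(\mathbb{Z}/p^n\mathbb{Z})\to\mathrm{GL}_2(\mathbb{Z}/p^m\mathbb{Z})$ be the reduction map. Suppose $H\le \mathrm{GL}_2(\mathbb{Z}/p^n\mathbb{Z})$ has $m$-uppertriangular tendencies and contains an element of the form $\begin{pmatrix} a & b\\ p^{k-1}c & d\end{pmatrix}$ with $c\not\equiv 0\pmod p$. Then $|H|\le p^{2n-2m+2k-2}\,|\pi(H)|$.
   Context: For a prime $\ell$ and integers $0\le m<n$, a subgroup $H\le\mathrm{GL}_2(\mathbb{Z}/\ell^n\mathbb{Z})$ has $m$-uppertriangular tendencies if for every $\begin{pmatrix} a&b\\ c&d\end{pmatrix}\in H$, $c\equiv 0\pmod{\ell^m}$ implies $c\equiv 0\pmod{\ell^n}$. -}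

module Defs where

open import Data.Nat using (ℕ; NonZero; _+_; _*_; _^_)
open import Data.Nat.Properties using (m^n≢0)
open import Data.Nat.DivMod using (_mod_)
open import Data.Nat.Primality using (Prime; prime⇒nonZero)
open import Data.Fin using (Fin; toℕ)
import Data.Fin.Properties as FinP
open import Data.Product using (Σ; _×_; _,_)
open import Data.List using (List; map; length; deduplicate)
open import Data.List.Membership.Propositional using (_∈_)
open import Relation.Binary.PropositionalEquality using (_≡_; refl; cong₂)
open import Relation.Binary.Definitions using (DecidableEquality)
open import Relation.Nullary using (yes; no)

record M2 (q : ℕ) : Set where
  constructor mat
  field
    a b c d : Fin q

module _ {q : ℕ} .{{_ : NonZero q}} where

  _⊕_ : Fin q → Fin q → Fin q
  x ⊕ y = (toℕ x + toℕ y) mod q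

  _⊗_ : Fin q → Fin q → Fin q
  x ⊗ y = (toℕ x * toℕ y) mod q

  infixl 6 _⊕_
  infixl 7 _⊗_

  _·_ : M2 q → M2 q → M2 q
  mat a b c d · mat a' b' c' d' =
    mat (a ⊗ a' ⊕ b ⊗ c') (a ⊗ b' ⊕ b ⊗ d') (c ⊗ a' ⊕ d ⊗ c') (c ⊗ b' ⊕ d ⊗ d')

  I₂ : M2 q
  I₂ = mat (1 mod q) (0 mod q) (0 mod q) (1 mod q)

_≟M_ : {q : ℕ} → DecidableEquality (M2 q)
mat a b c d ≟M mat a' b' c' d' with a FinP.≟ a' | b FinP.≟ b' | c FinP.≟ c' | d FinP.≟ d'
... | yes refl | yes refl | yes refl | yes refl = yes refl
... | no ne | _ | _ | _ = no (λ { refl → ne refl })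
... | yes _ | no ne | _ | _ = no (λ { refl → ne refl })
... | yes _ | yes _ | no ne | _ = no (λ { refl → ne refl })
... | yes _ | yes _ | yes _ | no ne = no (λ { refl → ne refl })

module _ {p : ℕ} (pr : Prime p) where

  private
    instance
      p≢0 : NonZero p
      p≢0 = prime⇒nonZero pr

  nz : (n : ℕ) → NonZero (p ^ n)
  nz n = m^n≢0 p n

  Mat : ℕ → Set
  Mat n = M2 (p ^ n)

  mul : (n : ℕ) → Mat n → Mat n → Mat n
  mul n g h = _·_ {{nz n}} g h

  one : (n : ℕ) → Mat n
  one n = I₂ {{nz n}}

  IsGL2 : (n : ℕ) → Mat n → Set
  IsGL2 n g = Σ (Mat n) λ h → (mul n g h ≡ one n) × (mul n h g ≡ one n)

  -- A finite subgroup H ≤ GL_2(Z/p^nZ), given as a duplicate-free list of its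
  -- elements (Unique is required separately in the statement).
  record IsSubgroupGL2 (n : ℕ) (H : List (Mat n)) : Set where
    field
      inGL   : ∀ {g} → g ∈ H → IsGL2 n g
      hasOne : one n ∈ H
      mulCl  : ∀ {g h} → g ∈ H → h ∈ H → mul n g h ∈ H
      invCl  : ∀ {g} → g ∈ H → Σ (Mat n) λ h → (h ∈ H) × (mul n g h ≡ one n) × (mul n h g ≡ one n)

  redFin : (n m : ℕ) → Fin (p ^ n) → Fin (p ^ m)
  redFin n m x = _mod_ (toℕ x) (p ^ m) {{nz m}}

  π : (n m : ℕ) → Mat n → Mat m
  π n m (mat a b c d) = mat (redFin n m a) (redFin n m b) (redFin n m c) (redFin n m d)

  imageSize : (n m : ℕ) → List (Mat n) → ℕ
  imageSize n m H = length (deduplicate _≟M_ (map (π n m) H))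

  resid : (n : ℕ) → ℕ → Fin (p ^ n)
  resid n x = _mod_ x (p ^ n) {{nz n}}

{-# OPTIONS --safe #-}
module Submission where

-- Each fibre of π on H is a coset of the kernel K = {u ∈ H | π u = 1}, so |H| ≤ |K| · |π(H)|.
-- An element u = (a b; c d) of K is ≡ 1 mod p^m, and the tendencies of H force c = 0. If g ∈ H
-- has bottom row (γ, δ) with γ = p^(k-1) c', then w = g u g⁻¹ also lies in K and wg = gu;
-- comparing bottom rows gives δγa ≡ γ(γb + δd) mod p^n. Hence a and d (p^(n-m) choices each)
-- determine b/p^m modulo p^(n-m-2(k-1)), leaving at most p^(2(k-1)) choices for b, and
-- |K| ≤ p^(2(n-m)+2(k-1)).

open import Data.Nat using (ℕ; zero; suc; _≤_; _<_; _+_; _*_; _∸_; _^_; z≤n; s≤s; NonZero; _%_; _/_; _≤?_)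
open import Data.Nat.Properties
open import Data.Nat.DivMod using (_mod_; m%n<n; m≡m%n+[m/n]*n; [m+kn]%n≡m%n; m<n⇒m%n≡m; m*[n/m]≡n; m<n*o⇒m/o<n)
open import Data.Nat.Divisibility
  using (_∣_; divides; 1∣_; ∣-trans; m∣m*n; ∣m+n∣m⇒∣n; *-monoʳ-∣; *-cancelˡ-∣; n∣m⇒m%n≡0)
open import Data.Nat.Primality using (Prime; euclidsLemma; prime⇒nonZero)
open import Data.Nat.Tactic.RingSolver using (solve-∀)
open import Data.Fin using (Fin; toℕ)
open import Data.Fin.Properties using (toℕ-injective; toℕ<n; toℕ-fromℕ<)
open import Data.Product using (Σ; _×_; _,_; proj₁; proj₂)
open import Data.Sum using (inj₁; inj₂; [_,_]′)
open import Data.Empty using (⊥-elim)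
open import Data.List using (List; []; _∷_; _++_; length; map; filter; deduplicate; cartesianProduct; upTo)
open import Data.List.Properties using (length-++; length-map; length-removeAt′; length-upTo)
open import Data.List.Membership.Propositional using (_∈_; _─_)
open import Data.List.Membership.Propositional.Properties
  using (∈-filter⁻; ∈-map⁺; ∈-deduplicate⁺; ∈-upTo⁺; ∈-cartesianProduct⁺)
open import Data.List.Relation.Unary.Any using (here; there; index)
import Data.List.Relation.Unary.All as All
open import Data.List.Relation.Unary.AllPairs using (_∷_)
open import Data.List.Relation.Unary.Unique.Propositional using (Unique)
open import Data.List.Relation.Unary.Unique.Propositional.Properties using (filter⁺)
open import Data.List.Relation.Binary.Subset.Propositional using (_⊆_)
open import Function using (_∘_)
open import Level using (0ℓ)
open import Relation.Nullary using (¬_; ¬?; Dec; yes; no)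
open import Relation.Unary using (Decidable)
open import Relation.Binary using (Setoid)
open import Relation.Binary.Definitions using (DecidableEquality)
open import Relation.Binary.PropositionalEquality
import Relation.Binary.Reasoning.Setoid as SetoidReasoning
open import Defs

-- Counting in duplicate-free lists

module _ {A : Set} where

  ∈-─⁺ : ∀ {x y : A} {xs} (x∈xs : x ∈ xs) → y ∈ xs → y ≢ x → y ∈ xs ─ x∈xs
  ∈-─⁺ (here refl) (here refl) y≢x = ⊥-elim (y≢x refl)
  ∈-─⁺ (here refl) (there y∈xs) _   = y∈xs
  ∈-─⁺ (there _)   (here refl)  _   = here refl
  ∈-─⁺ (there x∈xs) (there y∈xs) y≢x = there (∈-─⁺ x∈xs y∈xs y≢x)

  length-filter+length-filter-∁ : ∀ {P : A → Set} (P? : Decidable P) xs →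
    length (filter P? xs) + length (filter (¬? ∘ P?) xs) ≡ length xs
  length-filter+length-filter-∁ P? [] = refl
  length-filter+length-filter-∁ P? (x ∷ xs) with P? x
  ... | yes _ = cong suc (length-filter+length-filter-∁ P? xs)
  ... | no _  = trans (+-suc _ _) (cong suc (length-filter+length-filter-∁ P? xs))

module _ {A B : Set} where

  length-cartesianProduct : (xs : List A) (ys : List B) →
    length (cartesianProduct xs ys) ≡ length xs * length ys
  length-cartesianProduct []       ys = refl
  length-cartesianProduct (x ∷ xs) ys = begin
    length (map (x ,_) ys ++ cartesianProduct xs ys)          ≡⟨ length-++ (map (x ,_) ys) ⟩
    length (map (x ,_) ys) + length (cartesianProduct xs ys)  ≡⟨ cong₂ _+_ (length-map (x ,_) ys) (length-cartesianProduct xs ys) ⟩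
    length ys + length xs * length ys                         ∎
    where open ≡-Reasoning

  length-≤-injective : (f : A → B) {xs : List A} {ys : List B} → Unique xs →
    (∀ {x x'} → x ∈ xs → x' ∈ xs → f x ≡ f x' → x ≡ x') →
    (∀ {x} → x ∈ xs → f x ∈ ys) → length xs ≤ length ys
  length-≤-injective f {[]}     _               _   _  = z≤n
  length-≤-injective f {x ∷ xs} {ys} (x≢xs ∷ xs!) inj f∈ = begin
    suc (length xs)          ≤⟨ s≤s (length-≤-injective f xs! (λ x∈ x'∈ → inj (there x∈) (there x'∈)) f∈ys─fx) ⟩
    suc (length (ys ─ fx∈ys)) ≡⟨ length-removeAt′ ys (index fx∈ys) ⟨
    length ys                ∎
    where
    open ≤-Reasoning
    fx∈ys : f x ∈ ys
    fx∈ys = f∈ (here refl)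
    f∈ys─fx : ∀ {x'} → x' ∈ xs → f x' ∈ ys ─ fx∈ys
    f∈ys─fx x'∈xs = ∈-─⁺ fx∈ys (f∈ (there x'∈xs))
      (λ fx'≡fx → All.lookup x≢xs x'∈xs (sym (inj (there x'∈xs) (here refl) fx'≡fx)))

  module _ (f : A → B) (_≟_ : DecidableEquality B) {N : ℕ} {xs : List A}
    (fibre-bound : ∀ b {ys} → Unique ys → ys ⊆ xs → (∀ {y} → y ∈ ys → f y ≡ b) → length ys ≤ N) where

    private
      length-≤-over : ∀ D {zs} → Unique zs → zs ⊆ xs → (∀ {z} → z ∈ zs → f z ∈ D) → length zs ≤ N * length D
      length-≤-over []      {[]}    _ _ _  = z≤n
      length-≤-over []      {_ ∷ _} _ _ f∈ with () ← f∈ (here refl)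
      length-≤-over (b ∷ D) {zs} zs! zs⊆xs f∈ = begin
        length zs                          ≡⟨ length-filter+length-filter-∁ inFibre zs ⟨
        length (filter inFibre zs) + length (filter (¬? ∘ inFibre) zs)
          ≤⟨ +-mono-≤ (fibre-bound b (filter⁺ inFibre zs!) (zs⊆xs ∘ proj₁ ∘ ∈-inside) (proj₂ ∘ ∈-inside))
                      (length-≤-over D (filter⁺ (¬? ∘ inFibre) zs!) (zs⊆xs ∘ proj₁ ∘ ∈-outside) f∈D) ⟩
        N + N * length D                   ≡⟨ *-suc N (length D) ⟨
        N * length (b ∷ D)                 ∎
        where
        open ≤-Reasoning
        inFibre : ∀ z → Dec (f z ≡ b)
        inFibre z = f z ≟ b
        ∈-inside : ∀ {z} → z ∈ filter inFibre zs → z ∈ zs × f z ≡ b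
        ∈-inside = ∈-filter⁻ inFibre
        ∈-outside : ∀ {z} → z ∈ filter (¬? ∘ inFibre) zs → z ∈ zs × f z ≢ b
        ∈-outside = ∈-filter⁻ (¬? ∘ inFibre)
        f∈D : ∀ {z} → z ∈ filter (¬? ∘ inFibre) zs → f z ∈ D
        f∈D z∈ with z∈zs , fz≢b ← ∈-outside z∈ with f∈ z∈zs
        ...   | here fz≡b  = ⊥-elim (fz≢b fz≡b)
        ...   | there fz∈D = fz∈D

    length-≤-fibres : Unique xs → length xs ≤ N * length (deduplicate _≟_ (map f xs))
    length-≤-fibres xs! = length-≤-over _ xs! (λ x∈ → x∈) (∈-deduplicate⁺ _≟_ ∘ ∈-map⁺ f)

-- Congruences of natural numbers

infix 4 _≡_[mod_]
record _≡_[mod_] (x y q : ℕ) : Set where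
  constructor balanced
  field
    k l     : ℕ
    balance : x + k * q ≡ y + l * q

module _ {q : ℕ} where

  ≡-mod-reflexive : ∀ {x y} → x ≡ y → x ≡ y [mod q ]
  ≡-mod-reflexive refl = balanced 0 0 refl

  ≡-mod-refl : ∀ {x} → x ≡ x [mod q ]
  ≡-mod-refl = ≡-mod-reflexive refl

  ≡-mod-sym : ∀ {x y} → x ≡ y [mod q ] → y ≡ x [mod q ]
  ≡-mod-sym (balanced k l eq) = balanced l k (sym eq)

  private
    shift : ∀ x k k' q → x + (k + k') * q ≡ (x + k * q) + k' * q
    shift = solve-∀
    swap : ∀ x k k' q → (x + k * q) + k' * q ≡ (x + k' * q) + k * q
    swap = solve-∀

  ≡-mod-trans : ∀ {x y z} → x ≡ y [mod q ] → y ≡ z [mod q ] → x ≡ z [mod q ]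
  ≡-mod-trans {x} {y} {z} (balanced k l x≈y) (balanced k' l' y≈z) = balanced (k + k') (l' + l) (begin
    x + (k + k') * q       ≡⟨ shift x k k' q ⟩
    (x + k * q) + k' * q   ≡⟨ cong (_+ k' * q) x≈y ⟩
    (y + l * q) + k' * q   ≡⟨ swap y l k' q ⟩
    (y + k' * q) + l * q   ≡⟨ cong (_+ l * q) y≈z ⟩
    (z + l' * q) + l * q   ≡⟨ shift z l' l q ⟨
    z + (l' + l) * q       ∎)
    where open ≡-Reasoning

  ≡-mod-setoid : Setoid 0ℓ 0ℓ
  ≡-mod-setoid = record
    { Carrier = ℕ
    ; _≈_ = _≡_[mod q ]
    ; isEquivalence = record { refl = ≡-mod-refl ; sym = ≡-mod-sym ; trans = ≡-mod-trans }
    }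

  private
    +-balance : ∀ x u k k' q → (x + u) + (k + k') * q ≡ (x + k * q) + (u + k' * q)
    +-balance = solve-∀
    *-balance : ∀ x z k q → x * z + (k * z) * q ≡ (x + k * q) * z
    *-balance = solve-∀

  ≡-mod-+ : ∀ {x y u v} → x ≡ y [mod q ] → u ≡ v [mod q ] → x + u ≡ y + v [mod q ]
  ≡-mod-+ {x} {y} {u} {v} (balanced k l x≈y) (balanced k' l' u≈v) = balanced (k + k') (l + l') (begin
    (x + u) + (k + k') * q          ≡⟨ +-balance x u k k' q ⟩
    (x + k * q) + (u + k' * q)      ≡⟨ cong₂ _+_ x≈y u≈v ⟩
    (y + l * q) + (v + l' * q)      ≡⟨ +-balance y v l l' q ⟨
    (y + v) + (l + l') * q          ∎)
    where open ≡-Reasoning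

  ≡-mod-*ʳ : ∀ z {x y} → x ≡ y [mod q ] → x * z ≡ y * z [mod q ]
  ≡-mod-*ʳ z {x} {y} (balanced k l x≈y) = balanced (k * z) (l * z) (begin
    x * z + (k * z) * q   ≡⟨ *-balance x z k q ⟩
    (x + k * q) * z       ≡⟨ cong (_* z) x≈y ⟩
    (y + l * q) * z       ≡⟨ *-balance y z l q ⟨
    y * z + (l * z) * q   ∎)
    where open ≡-Reasoning

  ≡-mod-* : ∀ {x y u v} → x ≡ y [mod q ] → u ≡ v [mod q ] → x * u ≡ y * v [mod q ]
  ≡-mod-* {x} {y} {u} {v} x≈y u≈v = ≡-mod-trans (≡-mod-*ʳ u x≈y)
    (subst₂ (_≡_[mod q ]) (*-comm u y) (*-comm v y) (≡-mod-*ʳ y u≈v))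

  ≡-mod-+-cancelʳ : ∀ z {x y} → x + z ≡ y + z [mod q ] → x ≡ y [mod q ]
  ≡-mod-+-cancelʳ z {x} {y} (balanced k l eq) = balanced k l (+-cancelˡ-≡ z _ _ (begin
    z + (x + k * q)   ≡⟨ rearrange z x (k * q) ⟩
    (x + z) + k * q   ≡⟨ eq ⟩
    (y + z) + l * q   ≡⟨ rearrange z y (l * q) ⟨
    z + (y + l * q)   ∎))
    where
    open ≡-Reasoning
    rearrange : ∀ z x kq → z + (x + kq) ≡ (x + z) + kq
    rearrange = solve-∀

  ≡-mod-+ʳ⇒∣ : ∀ {x d} → x ≡ x + d [mod q ] → q ∣ d
  ≡-mod-+ʳ⇒∣ {x} {d} (balanced k l eq) = ∣m+n∣m⇒∣n (subst (q ∣_) kq≡lq+d (m∣m*n k)) (m∣m*n l)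
    where
    kq≡lq+d : q * k ≡ q * l + d
    kq≡lq+d = +-cancelˡ-≡ x _ _ (begin
      x + q * k        ≡⟨ cong (x +_) (*-comm q k) ⟩
      x + k * q        ≡⟨ eq ⟩
      (x + d) + l * q  ≡⟨ regroup x d l q ⟩
      x + (q * l + d)  ∎)
      where
      open ≡-Reasoning
      regroup : ∀ x d l q → (x + d) + l * q ≡ x + (q * l + d)
      regroup = solve-∀

  ∣⇒≡-mod-+ʳ : ∀ {x d} → q ∣ d → x ≡ x + d [mod q ]
  ∣⇒≡-mod-+ʳ {x} (divides t refl) = balanced t 0 (sym (+-identityʳ _))

  ≡-mod-0⇒∣ : ∀ {x} → x ≡ 0 [mod q ] → q ∣ x
  ≡-mod-0⇒∣ x≈0 = ≡-mod-+ʳ⇒∣ (≡-mod-sym x≈0)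

  ≡-mod-weaken : ∀ {q'} → q ∣ q' → ∀ {x y} → x ≡ y [mod q' ] → x ≡ y [mod q ]
  ≡-mod-weaken (divides t refl) {x} {y} (balanced k l eq) =
    balanced (k * t) (l * t) (subst₂ _≡_ (cong (x +_) (sym (*-assoc k t q))) (cong (y +_) (sym (*-assoc l t q))) eq)

  module _ .{{_ : NonZero q}} where

    %-≡-mod : ∀ x → x % q ≡ x [mod q ]
    %-≡-mod x = balanced (x / q) 0 (trans (sym (m≡m%n+[m/n]*n x q)) (sym (+-identityʳ x)))

    ≡-mod⇒%≡ : ∀ {x y} → x ≡ y [mod q ] → x % q ≡ y % q
    ≡-mod⇒%≡ {x} {y} (balanced k l eq) = begin
      x % q             ≡⟨ [m+kn]%n≡m%n x k q ⟨
      (x + k * q) % q   ≡⟨ cong (_% q) eq ⟩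
      (y + l * q) % q   ≡⟨ [m+kn]%n≡m%n y l q ⟩
      y % q             ∎
      where open ≡-Reasoning

    ≡-mod-<⇒≡ : ∀ {x y} → x < q → y < q → x ≡ y [mod q ] → x ≡ y
    ≡-mod-<⇒≡ x<q y<q x≈y = trans (sym (m<n⇒m%n≡m x<q)) (trans (≡-mod⇒%≡ x≈y) (m<n⇒m%n≡m y<q))

    ≡-mod∧/≡⇒≡ : ∀ {x y} → x ≡ y [mod q ] → x / q ≡ y / q → x ≡ y
    ≡-mod∧/≡⇒≡ {x} {y} x≈y x/q≡y/q = begin
      x                  ≡⟨ m≡m%n+[m/n]*n x q ⟩
      x % q + x / q * q  ≡⟨ cong₂ (λ r t → r + t * q) (≡-mod⇒%≡ x≈y) x/q≡y/q ⟩
      y % q + y / q * q  ≡⟨ m≡m%n+[m/n]*n y q ⟨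
      y                  ∎
      where open ≡-Reasoning

≡-mod-1 : ∀ x y → x ≡ y [mod 1 ]
≡-mod-1 x y = balanced y x (commute x y)
  where
  commute : ∀ x y → x + y * 1 ≡ y + x * 1
  commute = solve-∀

≡-mod-*-cancelˡ : ∀ d {q x y} .{{_ : NonZero d}} → d * x ≡ d * y [mod d * q ] → x ≡ y [mod q ]
≡-mod-*-cancelˡ d {q} {x} {y} (balanced k l eq) =
  balanced k l (*-cancelˡ-≡ _ _ d (trans (factor d x k q) (trans eq (sym (factor d y l q)))))
  where
  factor : ∀ d x k q → d * (x + k * q) ≡ d * x + k * (d * q)
  factor = solve-∀

^-monoʳ-∣ : ∀ b {m n} → m ≤ n → b ^ m ∣ b ^ n
^-monoʳ-∣ b {m} {n} m≤n = divides (b ^ (n ∸ m)) (trans (cong (b ^_) (sym (m∸n+n≡m m≤n))) (^-distribˡ-+-* b (n ∸ m) m))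

module _ {b : ℕ} .{{_ : NonZero b}} where

  ≡-mod-^-cancelˡ : ∀ e n {x y} → b ^ e * x ≡ b ^ e * y [mod b ^ n ] → x ≡ y [mod b ^ (n ∸ e) ]
  ≡-mod-^-cancelˡ e n {x} {y} eq with e ≤? n
  ... | yes e≤n = ≡-mod-*-cancelˡ (b ^ e) {{m^n≢0 b e}} (subst (_ ≡ _ [mod_]) b^n≡b^e*b^[n∸e] eq)
    where
    b^n≡b^e*b^[n∸e] : b ^ n ≡ b ^ e * b ^ (n ∸ e)
    b^n≡b^e*b^[n∸e] = trans (cong (b ^_) (sym (m+[n∸m]≡n e≤n))) (^-distribˡ-+-* b e (n ∸ e))
  ... | no e≰n rewrite m≤n⇒m∸n≡0 (<⇒≤ (≰⇒> e≰n)) = ≡-mod-1 x y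

module _ {p : ℕ} (pr : Prime p) where

  private instance
    p≢0 : NonZero p
    p≢0 = prime⇒nonZero pr

  p^r∣c*t⇒p^r∣t : ∀ {c} → ¬ p ∣ c → ∀ r {t} → p ^ r ∣ c * t → p ^ r ∣ t
  p^r∣c*t⇒p^r∣t p∤c zero    _ = 1∣ _
  p^r∣c*t⇒p^r∣t {c} p∤c (suc r) {t} p^[1+r]∣ct with euclidsLemma c t pr (∣-trans (m∣m*n (p ^ r)) p^[1+r]∣ct)
  ... | inj₁ p∣c = ⊥-elim (p∤c p∣c)
  ... | inj₂ (divides t′ refl) = subst (p * p ^ r ∣_) (*-comm p t′) (*-monoʳ-∣ p p^r∣t′)
    where
    regroup : ∀ c t′ p → c * (t′ * p) ≡ p * (c * t′)
    regroup = solve-∀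
    p^r∣t′ : p ^ r ∣ t′
    p^r∣t′ = p^r∣c*t⇒p^r∣t p∤c r (*-cancelˡ-∣ p (subst (p * p ^ r ∣_) (regroup c t′ p) p^[1+r]∣ct))

  private
    cancel-≤ : ∀ {c} → ¬ p ∣ c → ∀ r {x y} → x ≤ y → c * x ≡ c * y [mod p ^ r ] → x ≡ y [mod p ^ r ]
    cancel-≤ {c} p∤c r {x} {y} x≤y cx≈cy =
      subst (λ z → x ≡ z [mod p ^ r ]) (m+[n∸m]≡n x≤y)
        (∣⇒≡-mod-+ʳ (p^r∣c*t⇒p^r∣t p∤c r (≡-mod-+ʳ⇒∣ cx≈cx+c[y∸x])))
      where
      cx≈cx+c[y∸x] : c * x ≡ c * x + c * (y ∸ x) [mod p ^ r ]
      cx≈cx+c[y∸x] = subst (λ z → c * x ≡ z [mod p ^ r ])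
        (trans (cong (c *_) (sym (m+[n∸m]≡n x≤y))) (*-distribˡ-+ c x (y ∸ x))) cx≈cy

  ≡-mod-*-cancelˡ-coprime : ∀ {c} → ¬ p ∣ c → ∀ r {x y} → c * x ≡ c * y [mod p ^ r ] → x ≡ y [mod p ^ r ]
  ≡-mod-*-cancelˡ-coprime p∤c r {x} {y} cx≈cy with ≤-total x y
  ... | inj₁ x≤y = cancel-≤ p∤c r x≤y cx≈cy
  ... | inj₂ y≤x = ≡-mod-sym (cancel-≤ p∤c r y≤x (≡-mod-sym cx≈cy))

-- 2 × 2 matrices over ℤ/qℤ

record M2ℕ : Set where
  constructor matℕ
  field
    a b c d : ℕ

infixl 7 _⊠_
_⊠_ : M2ℕ → M2ℕ → M2ℕ
matℕ a b c d ⊠ matℕ a' b' c' d' =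
  matℕ (a * a' + b * c') (a * b' + b * d') (c * a' + d * c') (c * b' + d * d')

I₂ℕ : M2ℕ
I₂ℕ = matℕ 1 0 0 1

matℕ-cong : ∀ {a b c d a' b' c' d'} → a ≡ a' → b ≡ b' → c ≡ c' → d ≡ d' → matℕ a b c d ≡ matℕ a' b' c' d'
matℕ-cong refl refl refl refl = refl

private
  entry-assoc : ∀ a b a' b' c' d' x y → (a * a' + b * c') * x + (a * b' + b * d') * y ≡ a * (a' * x + b' * y) + b * (c' * x + d' * y)
  entry-assoc = solve-∀
  entry-unitˡ : ∀ x y → 1 * x + 0 * y ≡ x
  entry-unitˡ = solve-∀
  entry-unitˡ′ : ∀ x y → 0 * x + 1 * y ≡ y
  entry-unitˡ′ = solve-∀
  entry-unitʳ : ∀ x y → x * 1 + y * 0 ≡ x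
  entry-unitʳ = solve-∀
  entry-unitʳ′ : ∀ x y → x * 0 + y * 1 ≡ y
  entry-unitʳ′ = solve-∀

⊠-assoc : ∀ u v w → (u ⊠ v) ⊠ w ≡ u ⊠ (v ⊠ w)
⊠-assoc (matℕ a b c d) (matℕ a' b' c' d') (matℕ a'' b'' c'' d'') = matℕ-cong
  (entry-assoc a b a' b' c' d' a'' c'') (entry-assoc a b a' b' c' d' b'' d'')
  (entry-assoc c d a' b' c' d' a'' c'') (entry-assoc c d a' b' c' d' b'' d'')

⊠-identityˡ : ∀ u → I₂ℕ ⊠ u ≡ u
⊠-identityˡ (matℕ a b c d) = matℕ-cong (entry-unitˡ a c) (entry-unitˡ b d) (entry-unitˡ′ a c) (entry-unitˡ′ b d)

⊠-identityʳ : ∀ u → u ⊠ I₂ℕ ≡ u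
⊠-identityʳ (matℕ a b c d) = matℕ-cong (entry-unitʳ a b) (entry-unitʳ′ a b) (entry-unitʳ c d) (entry-unitʳ′ c d)

infix 4 _≋_[mod_]
record _≋_[mod_] (u v : M2ℕ) (q : ℕ) : Set where
  constructor entrywise
  field
    a : M2ℕ.a u ≡ M2ℕ.a v [mod q ]
    b : M2ℕ.b u ≡ M2ℕ.b v [mod q ]
    c : M2ℕ.c u ≡ M2ℕ.c v [mod q ]
    d : M2ℕ.d u ≡ M2ℕ.d v [mod q ]

module _ {q : ℕ} where

  ≋-reflexive : ∀ {u v} → u ≡ v → u ≋ v [mod q ]
  ≋-reflexive refl = entrywise ≡-mod-refl ≡-mod-refl ≡-mod-refl ≡-mod-refl

  ≋-refl : ∀ {u} → u ≋ u [mod q ]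
  ≋-refl = ≋-reflexive refl

  ≋-sym : ∀ {u v} → u ≋ v [mod q ] → v ≋ u [mod q ]
  ≋-sym (entrywise a b c d) = entrywise (≡-mod-sym a) (≡-mod-sym b) (≡-mod-sym c) (≡-mod-sym d)

  ≋-trans : ∀ {u v w} → u ≋ v [mod q ] → v ≋ w [mod q ] → u ≋ w [mod q ]
  ≋-trans (entrywise a b c d) (entrywise a' b' c' d') =
    entrywise (≡-mod-trans a a') (≡-mod-trans b b') (≡-mod-trans c c') (≡-mod-trans d d')

  ≋-setoid : Setoid 0ℓ 0ℓ
  ≋-setoid = record
    { Carrier = M2ℕ
    ; _≈_ = _≋_[mod q ]
    ; isEquivalence = record { refl = ≋-refl ; sym = ≋-sym ; trans = ≋-trans }
    }

  ≋-weaken : ∀ {q'} → q ∣ q' → ∀ {u v} → u ≋ v [mod q' ] → u ≋ v [mod q ]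
  ≋-weaken q∣q' (entrywise a b c d) =
    entrywise (≡-mod-weaken q∣q' a) (≡-mod-weaken q∣q' b) (≡-mod-weaken q∣q' c) (≡-mod-weaken q∣q' d)

  ⊠-cong : ∀ {u u' v v'} → u ≋ u' [mod q ] → v ≋ v' [mod q ] → u ⊠ v ≋ u' ⊠ v' [mod q ]
  ⊠-cong (entrywise a b c d) (entrywise a' b' c' d') =
    entrywise (entry a b a' c') (entry a b b' d') (entry c d a' c') (entry c d b' d')
    where
    entry : ∀ {x x' y y' z z' w w'} → x ≡ x' [mod q ] → y ≡ y' [mod q ] → z ≡ z' [mod q ] → w ≡ w' [mod q ] →
      x * z + y * w ≡ x' * z' + y' * w' [mod q ]
    entry x≈ y≈ z≈ w≈ = ≡-mod-+ (≡-mod-* x≈ z≈) (≡-mod-* y≈ w≈)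

  ⊠-congʳ : ∀ w {u u'} → u ≋ u' [mod q ] → u ⊠ w ≋ u' ⊠ w [mod q ]
  ⊠-congʳ w u≈u' = ⊠-cong u≈u' (≋-refl {w})

  ⊠-congˡ : ∀ w {v v'} → v ≋ v' [mod q ] → w ⊠ v ≋ w ⊠ v' [mod q ]
  ⊠-congˡ w v≈v' = ⊠-cong (≋-refl {w}) v≈v'

-- Identities of matrices over ℤ/qℤ are proved by lifting the entries to ℕ with ⌊_⌋, computing
-- with _⊠_ up to _≋_[mod q ], and coming back with ⌊⌋-injective.
⌊_⌋ : ∀ {q} → M2 q → M2ℕ
⌊ mat a b c d ⌋ = matℕ (toℕ a) (toℕ b) (toℕ c) (toℕ d)

module _ {q : ℕ} .{{_ : NonZero q}} where

  toℕ-mod : ∀ x → toℕ (x mod q) ≡ x [mod q ]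
  toℕ-mod x = ≡-mod-trans (≡-mod-reflexive (toℕ-fromℕ< (m%n<n x q))) (%-≡-mod x)

  toℕ-≡-mod-injective : ∀ {x y : Fin q} → toℕ x ≡ toℕ y [mod q ] → x ≡ y
  toℕ-≡-mod-injective {x} {y} x≈y = toℕ-injective (≡-mod-<⇒≡ (toℕ<n x) (toℕ<n y) x≈y)

  ⌊⌋-injective : ∀ {M N : M2 q} → ⌊ M ⌋ ≋ ⌊ N ⌋ [mod q ] → M ≡ N
  ⌊⌋-injective {mat _ _ _ _} {mat _ _ _ _} (entrywise a≈ b≈ c≈ d≈)
    with refl ← toℕ-≡-mod-injective a≈ | refl ← toℕ-≡-mod-injective b≈
       | refl ← toℕ-≡-mod-injective c≈ | refl ← toℕ-≡-mod-injective d≈ = refl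

  ⌊·⌋ : ∀ M N → ⌊ M · N ⌋ ≋ ⌊ M ⌋ ⊠ ⌊ N ⌋ [mod q ]
  ⌊·⌋ (mat a b c d) (mat a' b' c' d') = entrywise (entry a a' b c') (entry a b' b d') (entry c a' d c') (entry c b' d d')
    where
    entry : ∀ x y z w → toℕ (x ⊗ y ⊕ z ⊗ w) ≡ toℕ x * toℕ y + toℕ z * toℕ w [mod q ]
    entry x y z w = ≡-mod-trans (toℕ-mod _) (≡-mod-+ (toℕ-mod _) (toℕ-mod _))

  ⌊I₂⌋ : ⌊ I₂ ⌋ ≋ I₂ℕ [mod q ]
  ⌊I₂⌋ = entrywise (toℕ-mod 1) (toℕ-mod 0) (toℕ-mod 0) (toℕ-mod 1)

  ·-assoc : ∀ A B C → (A · B) · C ≡ A · (B · C)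
  ·-assoc A B C = ⌊⌋-injective (begin
    ⌊ (A · B) · C ⌋          ≈⟨ ⌊·⌋ (A · B) C ⟩
    ⌊ A · B ⌋ ⊠ ⌊ C ⌋        ≈⟨ ⊠-congʳ ⌊ C ⌋ (⌊·⌋ A B) ⟩
    (⌊ A ⌋ ⊠ ⌊ B ⌋) ⊠ ⌊ C ⌋  ≡⟨ ⊠-assoc ⌊ A ⌋ ⌊ B ⌋ ⌊ C ⌋ ⟩
    ⌊ A ⌋ ⊠ (⌊ B ⌋ ⊠ ⌊ C ⌋)  ≈⟨ ⊠-congˡ ⌊ A ⌋ (⌊·⌋ B C) ⟨
    ⌊ A ⌋ ⊠ ⌊ B · C ⌋        ≈⟨ ⌊·⌋ A (B · C) ⟨
    ⌊ A · (B · C) ⌋          ∎)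
    where open SetoidReasoning (≋-setoid {q})

  ·-identityˡ : ∀ A → I₂ · A ≡ A
  ·-identityˡ A = ⌊⌋-injective (begin
    ⌊ I₂ · A ⌋       ≈⟨ ⌊·⌋ I₂ A ⟩
    ⌊ I₂ ⌋ ⊠ ⌊ A ⌋   ≈⟨ ⊠-congʳ ⌊ A ⌋ ⌊I₂⌋ ⟩
    I₂ℕ ⊠ ⌊ A ⌋      ≡⟨ ⊠-identityˡ ⌊ A ⌋ ⟩
    ⌊ A ⌋            ∎)
    where open SetoidReasoning (≋-setoid {q})

  ·-identityʳ : ∀ A → A · I₂ ≡ A
  ·-identityʳ A = ⌊⌋-injective (begin
    ⌊ A · I₂ ⌋       ≈⟨ ⌊·⌋ A I₂ ⟩
    ⌊ A ⌋ ⊠ ⌊ I₂ ⌋   ≈⟨ ⊠-congˡ ⌊ A ⌋ ⌊I₂⌋ ⟩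
    ⌊ A ⌋ ⊠ I₂ℕ      ≡⟨ ⊠-identityʳ ⌊ A ⌋ ⟩
    ⌊ A ⌋            ∎)
    where open SetoidReasoning (≋-setoid {q})

  ·-cancelˡ : ∀ X Y {A B} → Y · X ≡ I₂ → X · A ≡ X · B → A ≡ B
  ·-cancelˡ X Y {A} {B} YX≡I XA≡XB = begin
    A              ≡⟨ ·-identityˡ A ⟨
    I₂ · A         ≡⟨ cong (_· A) YX≡I ⟨
    (Y · X) · A    ≡⟨ ·-assoc Y X A ⟩
    Y · (X · A)    ≡⟨ cong (Y ·_) XA≡XB ⟩
    Y · (X · B)    ≡⟨ ·-assoc Y X B ⟨
    (Y · X) · B    ≡⟨ cong (_· B) YX≡I ⟩
    I₂ · B         ≡⟨ ·-identityˡ B ⟩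
    B              ∎
    where open ≡-Reasoning

  ·-cancel-inverseʳ : ∀ Z Y X → Y · X ≡ I₂ → (Z · Y) · X ≡ Z
  ·-cancel-inverseʳ Z Y X YX≡I = begin
    (Z · Y) · X   ≡⟨ ·-assoc Z Y X ⟩
    Z · (Y · X)   ≡⟨ cong (Z ·_) YX≡I ⟩
    Z · I₂        ≡⟨ ·-identityʳ Z ⟩
    Z             ∎
    where open ≡-Reasoning

  private
    upper : M2 q → M2ℕ
    upper M = matℕ (toℕ (M2.a M)) (toℕ (M2.b M)) 0 (toℕ (M2.d M))

    ⌊⌋≋upper : ∀ M → toℕ (M2.c M) ≡ 0 → ⌊ M ⌋ ≋ upper M [mod q ]
    ⌊⌋≋upper (mat _ _ _ _) c≡0 = entrywise ≡-mod-refl ≡-mod-refl (≡-mod-reflexive c≡0) ≡-mod-refl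

    upper-conjugate : ∀ {g u w} → toℕ (M2.c u) ≡ 0 → toℕ (M2.c w) ≡ 0 → w · g ≡ g · u →
      upper w ⊠ ⌊ g ⌋ ≋ ⌊ g ⌋ ⊠ upper u [mod q ]
    upper-conjugate {g} {u} {w} cu≡0 cw≡0 wg≡gu = begin
      upper w ⊠ ⌊ g ⌋  ≈⟨ ⊠-congʳ ⌊ g ⌋ (⌊⌋≋upper w cw≡0) ⟨
      ⌊ w ⌋ ⊠ ⌊ g ⌋    ≈⟨ ⌊·⌋ w g ⟨
      ⌊ w · g ⌋        ≡⟨ cong ⌊_⌋ wg≡gu ⟩
      ⌊ g · u ⌋        ≈⟨ ⌊·⌋ g u ⟩
      ⌊ g ⌋ ⊠ ⌊ u ⌋    ≈⟨ ⊠-congˡ ⌊ g ⌋ (⌊⌋≋upper u cu≡0) ⟩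
      ⌊ g ⌋ ⊠ upper u  ∎
      where open SetoidReasoning (≋-setoid {q})

  -- The bottom rows of w g ≡ g u give d_w γ ≡ γ a and d_w δ ≡ γ b + δ d; eliminate d_w.
  upper-conjugacy : ∀ g u w → toℕ (M2.c u) ≡ 0 → toℕ (M2.c w) ≡ 0 → w · g ≡ g · u →
    let γ = toℕ (M2.c g); δ = toℕ (M2.d g) in
    δ * (γ * toℕ (M2.a u)) ≡ γ * (γ * toℕ (M2.b u) + δ * toℕ (M2.d u)) [mod q ]
  upper-conjugacy g u w cu≡0 cw≡0 wg≡gu = begin
    δ * (γ * a)            ≡⟨ regroupₐ δ γ a ⟩
    δ * (γ * a + δ * 0)    ≈⟨ ≡-mod-* (≡-mod-refl {x = δ}) (_≋_[mod_].c sides) ⟨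
    δ * (d′ * γ)           ≡⟨ regroup δ γ d′ ⟩
    γ * (d′ * δ)           ≈⟨ ≡-mod-* (≡-mod-refl {x = γ}) (_≋_[mod_].d sides) ⟩
    γ * (γ * b + δ * d)    ∎
    where
    open SetoidReasoning (≡-mod-setoid {q})
    γ δ a b d d′ : ℕ
    γ = toℕ (M2.c g)
    δ = toℕ (M2.d g)
    a = toℕ (M2.a u)
    b = toℕ (M2.b u)
    d = toℕ (M2.d u)
    d′ = toℕ (M2.d w)
    sides : upper w ⊠ ⌊ g ⌋ ≋ ⌊ g ⌋ ⊠ upper u [mod q ]
    sides = upper-conjugate {g} {u} {w} cu≡0 cw≡0 wg≡gu
    regroupₐ : ∀ δ γ a → δ * (γ * a) ≡ δ * (γ * a + δ * 0)
    regroupₐ = solve-∀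
    regroup : ∀ δ γ d′ → δ * (d′ * γ) ≡ γ * (d′ * δ)
    regroup = solve-∀

-- Reduction modulo p^m

module _ {p : ℕ} (pr : Prime p) where

  private instance
    p≢0 : NonZero p
    p≢0 = prime⇒nonZero pr

  ⌊π⌋ : ∀ n m (M : Mat pr n) → ⌊ π pr n m M ⌋ ≋ ⌊ M ⌋ [mod p ^ m ]
  ⌊π⌋ n m (mat a b c d) = entrywise (entry a) (entry b) (entry c) (entry d)
    where
    entry : (x : Fin (p ^ n)) → toℕ (redFin pr n m x) ≡ toℕ x [mod p ^ m ]
    entry x = toℕ-mod {{nz pr m}} (toℕ x)

  module _ {m n : ℕ} (m≤n : m ≤ n) where

    π-· : ∀ g h → π pr n m (mul pr n g h) ≡ mul pr m (π pr n m g) (π pr n m h)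
    π-· g h = ⌊⌋-injective {{nz pr m}} (begin
      ⌊ π pr n m (mul pr n g h) ⌋                  ≈⟨ ⌊π⌋ n m (mul pr n g h) ⟩
      ⌊ mul pr n g h ⌋                             ≈⟨ ≋-weaken (^-monoʳ-∣ p m≤n) (⌊·⌋ {{nz pr n}} g h) ⟩
      ⌊ g ⌋ ⊠ ⌊ h ⌋                                ≈⟨ ⊠-cong (⌊π⌋ n m g) (⌊π⌋ n m h) ⟨
      ⌊ π pr n m g ⌋ ⊠ ⌊ π pr n m h ⌋              ≈⟨ ⌊·⌋ {{nz pr m}} (π pr n m g) (π pr n m h) ⟨
      ⌊ mul pr m (π pr n m g) (π pr n m h) ⌋       ∎)
      where open SetoidReasoning (≋-setoid {p ^ m})

    π-one : π pr n m (one pr n) ≡ one pr m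
    π-one = ⌊⌋-injective {{nz pr m}} (begin
      ⌊ π pr n m (one pr n) ⌋  ≈⟨ ⌊π⌋ n m (one pr n) ⟩
      ⌊ one pr n ⌋             ≈⟨ ≋-weaken (^-monoʳ-∣ p m≤n) (⌊I₂⌋ {{nz pr n}}) ⟩
      I₂ℕ                      ≈⟨ ⌊I₂⌋ {{nz pr m}} ⟨
      ⌊ one pr m ⌋             ∎)
      where open SetoidReasoning (≋-setoid {p ^ m})

    π-·-congˡ : ∀ z {y y'} → π pr n m y ≡ π pr n m y' → π pr n m (mul pr n z y) ≡ π pr n m (mul pr n z y')
    π-·-congˡ z {y} {y'} πy≡πy' = begin
      π pr n m (mul pr n z y)                ≡⟨ π-· z y ⟩
      mul pr m (π pr n m z) (π pr n m y)     ≡⟨ cong (mul pr m (π pr n m z)) πy≡πy' ⟩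
      mul pr m (π pr n m z) (π pr n m y')    ≡⟨ π-· z y' ⟨
      π pr n m (mul pr n z y')               ∎
      where open ≡-Reasoning

    π-·-congʳ : ∀ z {y y'} → π pr n m y ≡ π pr n m y' → π pr n m (mul pr n y z) ≡ π pr n m (mul pr n y' z)
    π-·-congʳ z {y} {y'} πy≡πy' = begin
      π pr n m (mul pr n y z)                ≡⟨ π-· y z ⟩
      mul pr m (π pr n m y) (π pr n m z)     ≡⟨ cong (λ t → mul pr m t (π pr n m z)) πy≡πy' ⟩
      mul pr m (π pr n m y') (π pr n m z)    ≡⟨ π-· y' z ⟨
      π pr n m (mul pr n y' z)               ∎
      where open ≡-Reasoning

-- The kernel of the reduction on H

module Kernel {p : ℕ} (pr : Prime p) {m n : ℕ} (m≤n : m ≤ n)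
  {H : List (Mat pr n)} (H≤GL₂ : IsSubgroupGL2 pr n H)
  (tendencies : ∀ g → g ∈ H → p ^ m ∣ toℕ (M2.c g) → p ^ n ∣ toℕ (M2.c g)) where

  open IsSubgroupGL2 H≤GL₂

  private instance
    p≢0 : NonZero p
    p≢0 = prime⇒nonZero pr
    p^m≢0 : NonZero (p ^ m)
    p^m≢0 = nz pr m
    p^n≢0 : NonZero (p ^ n)
    p^n≢0 = nz pr n

  InKernel : Mat pr n → Set
  InKernel u = u ∈ H × π pr n m u ≡ one pr m

  kernel-≋-I₂ : ∀ {u} → InKernel u → ⌊ u ⌋ ≋ I₂ℕ [mod p ^ m ]
  kernel-≋-I₂ {u} (_ , πu≡1) = begin
    ⌊ u ⌋             ≈⟨ ⌊π⌋ pr n m u ⟨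
    ⌊ π pr n m u ⌋    ≡⟨ cong ⌊_⌋ πu≡1 ⟩
    ⌊ one pr m ⌋      ≈⟨ ⌊I₂⌋ ⟩
    I₂ℕ               ∎
    where open SetoidReasoning (≋-setoid {p ^ m})

  kernel-≋ : ∀ {u u'} → InKernel u → InKernel u' → ⌊ u ⌋ ≋ ⌊ u' ⌋ [mod p ^ m ]
  kernel-≋ u∈K u'∈K = ≋-trans (kernel-≋-I₂ u∈K) (≋-sym (kernel-≋-I₂ u'∈K))

  kernel-c≡0 : ∀ {u} → InKernel u → toℕ (M2.c u) ≡ 0
  kernel-c≡0 {u} u∈K@(u∈H , _) = begin
    toℕ (M2.c u)          ≡⟨ m<n⇒m%n≡m (toℕ<n (M2.c u)) ⟨
    toℕ (M2.c u) % p ^ n  ≡⟨ n∣m⇒m%n≡0 _ (p ^ n) (tendencies u u∈H p^m∣c) ⟩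
    0                     ∎
    where
    open ≡-Reasoning
    p^m∣c : p ^ m ∣ toℕ (M2.c u)
    p^m∣c = ≡-mod-0⇒∣ (_≋_[mod_].c (kernel-≋-I₂ u∈K))

  conjugate-in-kernel : ∀ {g g⁻¹ u} → g ∈ H → g⁻¹ ∈ H → mul pr n g g⁻¹ ≡ one pr n →
    InKernel u → InKernel (mul pr n (mul pr n g u) g⁻¹)
  conjugate-in-kernel {g} {g⁻¹} {u} g∈H g⁻¹∈H gg⁻¹≡1 (u∈H , πu≡1) =
    mulCl (mulCl g∈H u∈H) g⁻¹∈H , (begin
      π pr n m (mul pr n (mul pr n g u) g⁻¹)           ≡⟨ π-·-congʳ pr m≤n g⁻¹ (π-·-congˡ pr m≤n g πu≡π1) ⟩
      π pr n m (mul pr n (mul pr n g (one pr n)) g⁻¹)  ≡⟨ cong (λ t → π pr n m (mul pr n t g⁻¹)) (·-identityʳ g) ⟩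
      π pr n m (mul pr n g g⁻¹)                        ≡⟨ cong (π pr n m) gg⁻¹≡1 ⟩
      π pr n m (one pr n)                              ≡⟨ π-one pr m≤n ⟩
      one pr m                                         ∎)
    where
    open ≡-Reasoning
    πu≡π1 : π pr n m u ≡ π pr n m (one pr n)
    πu≡π1 = trans πu≡1 (sym (π-one pr m≤n))

  translate-into-kernel : ∀ {x x⁻¹ y} → x⁻¹ ∈ H → mul pr n x⁻¹ x ≡ one pr n →
    y ∈ H → π pr n m y ≡ π pr n m x → InKernel (mul pr n x⁻¹ y)
  translate-into-kernel {x} {x⁻¹} {y} x⁻¹∈H x⁻¹x≡1 y∈H πy≡πx = mulCl x⁻¹∈H y∈H , (begin
    π pr n m (mul pr n x⁻¹ y)  ≡⟨ π-·-congˡ pr m≤n x⁻¹ πy≡πx ⟩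
    π pr n m (mul pr n x⁻¹ x)  ≡⟨ cong (π pr n m) x⁻¹x≡1 ⟩
    π pr n m (one pr n)        ≡⟨ π-one pr m≤n ⟩
    one pr m                   ∎)
    where open ≡-Reasoning

  module _ {g : Mat pr n} (g∈H : g ∈ H) {k c : ℕ} (p∤c : ¬ p ∣ c)
    (g-c : M2.c g ≡ resid pr n (p ^ (k ∸ 1) * c)) where

    j s r : ℕ
    j = (k ∸ 1) + (k ∸ 1)
    s = n ∸ m
    r = n ∸ (m + j)

    private
      instance
        p^r≢0 : NonZero (p ^ r)
        p^r≢0 = nz pr r
      γ δ : ℕ
      γ = toℕ (M2.c g)
      δ = toℕ (M2.d g)

    kernel-relation : ∀ {u} → InKernel u →
      δ * (γ * toℕ (M2.a u)) ≡ γ * (γ * toℕ (M2.b u) + δ * toℕ (M2.d u)) [mod p ^ n ]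
    kernel-relation {u} u∈K with g⁻¹ , g⁻¹∈H , gg⁻¹≡1 , g⁻¹g≡1 ← invCl g∈H =
      upper-conjugacy g u (mul pr n (mul pr n g u) g⁻¹) (kernel-c≡0 u∈K)
        (kernel-c≡0 (conjugate-in-kernel g∈H g⁻¹∈H gg⁻¹≡1 u∈K)) (·-cancel-inverseʳ (mul pr n g u) g⁻¹ g g⁻¹g≡1)

    kernel-γ²b : ∀ {u u'} → InKernel u → InKernel u' →
      toℕ (M2.a u) ≡ toℕ (M2.a u') → toℕ (M2.d u) ≡ toℕ (M2.d u') →
      γ * (γ * toℕ (M2.b u)) ≡ γ * (γ * toℕ (M2.b u')) [mod p ^ n ]
    kernel-γ²b {u} {u'} u∈K u'∈K a≡a' d≡d' = ≡-mod-+-cancelʳ (γ * (δ * d)) (begin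
      γ * (γ * b) + γ * (δ * d)     ≡⟨ *-distribˡ-+ γ (γ * b) (δ * d) ⟨
      γ * (γ * b + δ * d)           ≈⟨ kernel-relation u∈K ⟨
      δ * (γ * a)                   ≡⟨ cong (λ t → δ * (γ * t)) a≡a' ⟩
      δ * (γ * a')                  ≈⟨ kernel-relation u'∈K ⟩
      γ * (γ * b' + δ * d')         ≡⟨ cong (λ t → γ * (γ * b' + δ * t)) d≡d' ⟨
      γ * (γ * b' + δ * d)          ≡⟨ *-distribˡ-+ γ (γ * b') (δ * d) ⟩
      γ * (γ * b') + γ * (δ * d)    ∎)
      where
      open SetoidReasoning (≡-mod-setoid {p ^ n})
      a a' b b' d d' : ℕ
      a = toℕ (M2.a u)
      a' = toℕ (M2.a u')
      b = toℕ (M2.b u)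
      b' = toℕ (M2.b u')
      d = toℕ (M2.d u)
      d' = toℕ (M2.d u')

    private
      G : ℕ
      G = p ^ (k ∸ 1) * c

      γ≡G : γ ≡ G [mod p ^ n ]
      γ≡G = ≡-mod-trans (≡-mod-reflexive (cong toℕ g-c)) (toℕ-mod G)

      p∤c*c : ¬ p ∣ c * c
      p∤c*c p∣c*c = [ p∤c , p∤c ]′ (euclidsLemma c c pr p∣c*c)

      kernel-b≡p^m*b/p^m : ∀ {u} → InKernel u → toℕ (M2.b u) ≡ p ^ m * (toℕ (M2.b u) / p ^ m)
      kernel-b≡p^m*b/p^m u∈K = sym (m*[n/m]≡n (≡-mod-0⇒∣ (_≋_[mod_].b (kernel-≋-I₂ u∈K))))

      G²p^m≡p^[m+j] : ∀ y → G * (G * (p ^ m * y)) ≡ p ^ (m + j) * (c * c * y)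
      G²p^m≡p^[m+j] y = begin
        G * (G * (p ^ m * y))                              ≡⟨ regroup (p ^ m) (p ^ (k ∸ 1)) c y ⟩
        p ^ m * (p ^ (k ∸ 1) * p ^ (k ∸ 1)) * (c * c * y)
          ≡⟨ cong (λ t → p ^ m * t * (c * c * y)) (^-distribˡ-+-* p (k ∸ 1) (k ∸ 1)) ⟨
        p ^ m * p ^ j * (c * c * y)                        ≡⟨ cong (_* (c * c * y)) (^-distribˡ-+-* p m j) ⟨
        p ^ (m + j) * (c * c * y)                          ∎
        where
        open ≡-Reasoning
        regroup : ∀ q t c y → t * c * (t * c * (q * y)) ≡ q * (t * t) * (c * c * y)
        regroup = solve-∀

    kernel-b/p^m : ∀ {u u'} → InKernel u → InKernel u' →
      toℕ (M2.a u) ≡ toℕ (M2.a u') → toℕ (M2.d u) ≡ toℕ (M2.d u') →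
      toℕ (M2.b u) / p ^ m ≡ toℕ (M2.b u') / p ^ m [mod p ^ r ]
    kernel-b/p^m {u} {u'} u∈K u'∈K a≡a' d≡d' =
      ≡-mod-*-cancelˡ-coprime pr p∤c*c r (≡-mod-^-cancelˡ (m + j) n (begin
        p ^ (m + j) * (c * c * y)         ≡⟨ G²p^m≡p^[m+j] y ⟨
        G * (G * (p ^ m * y))             ≡⟨ cong (λ t → G * (G * t)) (kernel-b≡p^m*b/p^m u∈K) ⟨
        G * (G * b)                       ≈⟨ ≡-mod-* γ≡G (≡-mod-* γ≡G (≡-mod-refl {x = b})) ⟨
        γ * (γ * b)                       ≈⟨ kernel-γ²b u∈K u'∈K a≡a' d≡d' ⟩
        γ * (γ * b')                      ≈⟨ ≡-mod-* γ≡G (≡-mod-* γ≡G (≡-mod-refl {x = b'})) ⟩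
        G * (G * b')                      ≡⟨ cong (λ t → G * (G * t)) (kernel-b≡p^m*b/p^m u'∈K) ⟩
        G * (G * (p ^ m * y'))            ≡⟨ G²p^m≡p^[m+j] y' ⟩
        p ^ (m + j) * (c * c * y')        ∎))
      where
      open SetoidReasoning (≡-mod-setoid {p ^ n})
      b b' y y' : ℕ
      b = toℕ (M2.b u)
      b' = toℕ (M2.b u')
      y = b / p ^ m
      y' = b' / p ^ m

    -- On the kernel, a ≡ d ≡ 1 and b ≡ 0 mod p^m, and b/p^m mod p^r is fixed by a and d
    -- (kernel-b/p^m); so these three quotients determine the element.
    coordinates : Mat pr n → ℕ × ℕ × ℕ
    coordinates u = toℕ (M2.a u) / p ^ m , toℕ (M2.d u) / p ^ m , (toℕ (M2.b u) / p ^ m) / p ^ r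

    coordinates-injective : ∀ {u u'} → InKernel u → InKernel u' → coordinates u ≡ coordinates u' → u ≡ u'
    coordinates-injective {u} {u'} u∈K u'∈K eq = ⌊⌋-injective (≋-reflexive (matℕ-cong a≡a' b≡b' c≡c' d≡d'))
      where
      u≈u' : ⌊ u ⌋ ≋ ⌊ u' ⌋ [mod p ^ m ]
      u≈u' = kernel-≋ u∈K u'∈K
      a≡a' : toℕ (M2.a u) ≡ toℕ (M2.a u')
      a≡a' = ≡-mod∧/≡⇒≡ (_≋_[mod_].a u≈u') (cong proj₁ eq)
      d≡d' : toℕ (M2.d u) ≡ toℕ (M2.d u')
      d≡d' = ≡-mod∧/≡⇒≡ (_≋_[mod_].d u≈u') (cong (proj₁ ∘ proj₂) eq)
      c≡c' : toℕ (M2.c u) ≡ toℕ (M2.c u')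
      c≡c' = trans (kernel-c≡0 u∈K) (sym (kernel-c≡0 u'∈K))
      b≡b' : toℕ (M2.b u) ≡ toℕ (M2.b u')
      b≡b' = ≡-mod∧/≡⇒≡ (_≋_[mod_].b u≈u')
        (≡-mod∧/≡⇒≡ (kernel-b/p^m u∈K u'∈K a≡a' d≡d') (cong (proj₂ ∘ proj₂) eq))

    box : List (ℕ × ℕ × ℕ)
    box = cartesianProduct (upTo (p ^ s)) (cartesianProduct (upTo (p ^ s)) (upTo (p ^ j)))

    length-box : length box ≡ p ^ s * (p ^ s * p ^ j)
    length-box = begin
      length box
        ≡⟨ length-cartesianProduct (upTo (p ^ s)) _ ⟩
      length (upTo (p ^ s)) * length (cartesianProduct (upTo (p ^ s)) (upTo (p ^ j)))
        ≡⟨ cong₂ _*_ (length-upTo (p ^ s)) (length-cartesianProduct (upTo (p ^ s)) (upTo (p ^ j))) ⟩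
      p ^ s * (length (upTo (p ^ s)) * length (upTo (p ^ j)))
        ≡⟨ cong (p ^ s *_) (cong₂ _*_ (length-upTo (p ^ s)) (length-upTo (p ^ j))) ⟩
      p ^ s * (p ^ s * p ^ j)
        ∎
      where open ≡-Reasoning

    coordinates-∈-box : ∀ u → coordinates u ∈ box
    coordinates-∈-box u = ∈-cartesianProduct⁺ (∈-upTo⁺ (x/p^m<p^s (M2.a u)))
      (∈-cartesianProduct⁺ (∈-upTo⁺ (x/p^m<p^s (M2.d u))) (∈-upTo⁺ (m<n*o⇒m/o<n b/p^m<p^j*p^r)))
      where
      x/p^m<p^s : (x : Fin (p ^ n)) → toℕ x / p ^ m < p ^ s
      x/p^m<p^s x = m<n*o⇒m/o<n (subst (toℕ x <_) p^n≡p^s*p^m (toℕ<n x))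
        where
        p^n≡p^s*p^m : p ^ n ≡ p ^ s * p ^ m
        p^n≡p^s*p^m = trans (cong (p ^_) (sym (m∸n+n≡m m≤n))) (^-distribˡ-+-* p s m)
      b/p^m<p^j*p^r : toℕ (M2.b u) / p ^ m < p ^ j * p ^ r
      b/p^m<p^j*p^r = <-≤-trans (x/p^m<p^s (M2.b u)) (begin
        p ^ s              ≤⟨ ^-monoʳ-≤ p (m≤n+m∸n s j) ⟩
        p ^ (j + (s ∸ j))  ≡⟨ cong (λ t → p ^ (j + t)) (∸-+-assoc n m j) ⟩
        p ^ (j + r)        ≡⟨ ^-distribˡ-+-* p j r ⟩
        p ^ j * p ^ r      ∎)
        where open ≤-Reasoning

    fibre-size : ∀ b {ys} → Unique ys → ys ⊆ H → (∀ {y} → y ∈ ys → π pr n m y ≡ b) →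
      length ys ≤ p ^ s * (p ^ s * p ^ j)
    fibre-size b {[]}     _   _    _   = z≤n
    fibre-size b {y₀ ∷ ys} ys! ys⊆H πy≡b with x , x∈H , y₀x≡1 , xy₀≡1 ← invCl (ys⊆H (here refl)) = begin
      length (y₀ ∷ ys)         ≤⟨ length-≤-injective (coordinates ∘ mul pr n x) ys! injective in-box ⟩
      length box               ≡⟨ length-box ⟩
      p ^ s * (p ^ s * p ^ j)  ∎
      where
      open ≤-Reasoning
      xy∈K : ∀ {y} → y ∈ y₀ ∷ ys → InKernel (mul pr n x y)
      xy∈K y∈ = translate-into-kernel x∈H xy₀≡1 (ys⊆H y∈) (trans (πy≡b y∈) (sym (πy≡b (here refl))))
      injective : ∀ {y y'} → y ∈ y₀ ∷ ys → y' ∈ y₀ ∷ ys →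
        coordinates (mul pr n x y) ≡ coordinates (mul pr n x y') → y ≡ y'
      injective y∈ y'∈ eq = ·-cancelˡ x y₀ y₀x≡1 (coordinates-injective (xy∈K y∈) (xy∈K y'∈) eq)
      in-box : ∀ {y} → y ∈ y₀ ∷ ys → coordinates (mul pr n x y) ∈ box
      in-box {y} _ = coordinates-∈-box (mul pr n x y)

2n∸2m+2k∸2≡2[n∸m]+2[k∸1] : ∀ {k} m n → 1 ≤ k →
  2 * n ∸ 2 * m + 2 * k ∸ 2 ≡ (n ∸ m) + ((n ∸ m) + ((k ∸ 1) + (k ∸ 1)))
2n∸2m+2k∸2≡2[n∸m]+2[k∸1] {k} m n 1≤k = begin
  2 * n ∸ 2 * m + 2 * k ∸ 2        ≡⟨ cong (λ t → t + 2 * k ∸ 2) (*-distribˡ-∸ 2 n m) ⟨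
  2 * (n ∸ m) + 2 * k ∸ 2          ≡⟨ +-∸-assoc (2 * (n ∸ m)) (*-monoʳ-≤ 2 1≤k) ⟩
  2 * (n ∸ m) + (2 * k ∸ 2 * 1)    ≡⟨ cong (2 * (n ∸ m) +_) (*-distribˡ-∸ 2 k 1) ⟨
  2 * (n ∸ m) + 2 * (k ∸ 1)        ≡⟨ double (n ∸ m) (k ∸ 1) ⟩
  (n ∸ m) + ((n ∸ m) + ((k ∸ 1) + (k ∸ 1))) ∎
  where
  open ≡-Reasoning
  double : ∀ s t → 2 * s + 2 * t ≡ s + (s + (t + t))
  double = solve-∀

proposition2p13 : (p : ℕ) (pr : Prime p) (k m n : ℕ) → 1 ≤ k → k ≤ m → m < n →
    (H : List (Mat pr n)) → Unique H → IsSubgroupGL2 pr n H →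
    -- m-uppertriangular tendencies
    (∀ g → g ∈ H → p ^ m ∣ toℕ (M2.c g) → p ^ n ∣ toℕ (M2.c g)) →
    -- H contains an element whose lower-left entry is p^(k-1) c with p ∤ c
    (Σ (Mat pr n) λ g → (g ∈ H) × Σ ℕ λ c → (¬ p ∣ c) ×
       (M2.c g ≡ resid pr n (p ^ (k ∸ 1) * c))) →
    length H ≤ p ^ (2 * n ∸ 2 * m + 2 * k ∸ 2) * imageSize pr n m H
proposition2p13 p pr k m n 1≤k _ m<n H H! H≤GL₂ tendencies (g , g∈H , c , p∤c , g-c) = begin
  length H                                              ≤⟨ length-≤-fibres (π pr n m) _≟M_ fibre-bound H! ⟩
  p ^ s * (p ^ s * p ^ j) * imageSize pr n m H          ≡⟨ cong (_* imageSize pr n m H) p^s*[p^s*p^j]≡p^E ⟩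
  p ^ (2 * n ∸ 2 * m + 2 * k ∸ 2) * imageSize pr n m H  ∎
  where
  open ≤-Reasoning
  open Kernel pr (<⇒≤ m<n) H≤GL₂ tendencies using (fibre-size)
  s j : ℕ
  s = n ∸ m
  j = (k ∸ 1) + (k ∸ 1)
  fibre-bound : ∀ b {ys} → Unique ys → ys ⊆ H → (∀ {y} → y ∈ ys → π pr n m y ≡ b) →
    length ys ≤ p ^ s * (p ^ s * p ^ j)
  fibre-bound = fibre-size g∈H {k} p∤c g-c
  p^s*[p^s*p^j]≡p^E : p ^ s * (p ^ s * p ^ j) ≡ p ^ (2 * n ∸ 2 * m + 2 * k ∸ 2)
  p^s*[p^s*p^j]≡p^E = begin-equality
    p ^ s * (p ^ s * p ^ j)             ≡⟨ cong (p ^ s *_) (^-distribˡ-+-* p s j) ⟨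
    p ^ s * p ^ (s + j)                 ≡⟨ ^-distribˡ-+-* p s (s + j) ⟨
    p ^ (s + (s + j))                   ≡⟨ cong (p ^_) (2n∸2m+2k∸2≡2[n∸m]+2[k∸1] m n 1≤k) ⟨
    p ^ (2 * n ∸ 2 * m + 2 * k ∸ 2)     ∎
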